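{- Let $V$ be the set of positive integers $N$ that cannot be written as $N = A/B$ with $A, B$ antipalindromic numbers. Then the lower density of $V$ satisfies $\liminf_{n\to\infty} \frac{1}{n}|V \cap \{1,\dots,n\}| \ge 1/60$.
   Context: A positive integer is antipalindromic if its base-$2$ representation (without leading zeros) $w_1 \cdots w_{2m}$ has even length and satisfies $w_i + w_{2m+1-i} = 1$ for all $i$ (the second half is the reverse complement of the first half). -}

module Defs where

open import Data.Nat using (ℕ; zero; suc; _+_; _*_; _∸_; _≤_)
open import Data.Bool using (Bool; true; false; not)
open import Data.List using (List; []; _∷_; _++_; reverse; map; foldl; length)
open import Data.List.Relation.Unary.All using (All)
open import Data.List.Relation.Unary.Unique.Propositional using (Unique)
open import Data.Product using (Σ; ∃; _×_)
open import Relation.Nullary using (¬_)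
open import Relation.Binary.PropositionalEquality using (_≡_)

bit : Bool → ℕ
bit true  = 1
bit false = 0

fromBits : List Bool → ℕ
fromBits = foldl (λ acc b → 2 * acc + bit b) 0

-- A binary word w₁…w₂ₘ (MSB first, no leading zero, i.e. w₁ = 1) with
-- wᵢ + w₂ₘ₊₁₋ᵢ = 1 is exactly  h ++ reverse (map not h)  with h = true ∷ u
-- (h = first half w₁…wₘ).
antiWord : List Bool → List Bool
antiWord u = (true ∷ u) ++ reverse (map not (true ∷ u))

Antipalindromic : ℕ → Set
Antipalindromic N = ∃ λ (u : List Bool) → fromBits (antiWord u) ≡ N

-- N = A / B with A, B antipalindromic (B ≥ 2 automatically), i.e. A = N * B
RatioOfAntipal : ℕ → Set
RatioOfAntipal N = Σ ℕ λ A → Σ ℕ λ B →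
  Antipalindromic A × Antipalindromic B × A ≡ N * B

InV : ℕ → Set
InV N = 1 ≤ N × ¬ RatioOfAntipal N

-- "|V ∩ {1,…,n}| ≥ m": m distinct elements of V in {1,…,n}
CountAtLeast : ℕ → ℕ → Set
CountAtLeast n m = ∃ λ (L : List ℕ) →
  Unique L × All (λ x → InV x × x ≤ n) L × m ≤ length L

-- If the first half of an antipalindrome of length 2m starts with exactly t ≥ 1
-- ones, then the word ends in exactly t zeros, so its 2-adic valuation is t, and
-- its value lies in [(1 - 2⁻ᵗ)·4ᵐ, (1 - 2⁻⁽ᵗ⁺¹⁾)·4ᵐ).  If A = N·B with N odd, then A
-- and B share t, so N = A/B is within a factor 3/2 of a power of 4.  The odd N in
-- [2·4ᴶ⁺¹, 2·4ᴶ⁺¹ + 2·4ᴶ) are not, so they lie in V; since every n ≥ 10 lies in some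
-- [10·4ᴶ, 40·4ᴶ), this already gives lower density at least 1/40.
module Submission where

open import Defs
open import Data.Nat
open import Data.Nat.Properties
open import Data.Nat.Tactic.RingSolver using (solve-∀)
open import Data.Bool using (Bool; true; false; not)
open import Data.Empty using (⊥-elim)
open import Data.List using (List; []; _∷_; _++_; [_]; reverse; map; foldl; length; upTo)
open import Data.List.Properties
  using (foldl-++; length-++; length-reverse; length-map; unfold-reverse; ++-assoc; length-upTo)
import Data.List.Relation.Unary.All as All
open import Data.List.Relation.Unary.All.Properties using (all-upTo) renaming (map⁺ to all-map⁺)
import Data.List.Relation.Unary.Unique.Propositional.Properties as Unique
open import Data.Product using (∃; ∃₂; _×_; _,_)
open import Relation.Nullary using (¬_; yes; no)
open import Relation.Binary.PropositionalEquality
  using (_≡_; refl; sym; trans; cong; cong₂; subst; subst₂; module ≡-Reasoning)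

Odd : ℕ → Set
Odd n = ∃ λ k → n ≡ suc (2 * k)

Odd-* : ∀ {m n} → Odd m → Odd n → Odd (m * n)
Odd-* (a , refl) (b , refl) = a + b + 2 * a * b , identity a b
  where
  identity : ∀ a b → suc (2 * a) * suc (2 * b) ≡ suc (2 * (a + b + 2 * a * b))
  identity = solve-∀

2-adic-unique : ∀ a b {x y} → Odd x → Odd y → 2 ^ a * x ≡ 2 ^ b * y → a ≡ b
2-adic-unique zero    zero    _        _        _ = refl
2-adic-unique zero    (suc b) {y = y} (k , refl) _ eq =
  ⊥-elim (even≢odd (2 ^ b * y) k (sym (trans (sym (*-identityˡ _)) (trans eq (*-assoc 2 (2 ^ b) y)))))
2-adic-unique (suc a) zero    {x = x} _ (k , refl) eq =
  ⊥-elim (even≢odd (2 ^ a * x) k (sym (trans (sym (*-identityˡ _)) (trans (sym eq) (*-assoc 2 (2 ^ a) x)))))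
2-adic-unique (suc a) (suc b) {x} {y} ox oy eq =
  cong suc (2-adic-unique a b ox oy (*-cancelˡ-≡ _ _ 2 (trans (sym (*-assoc 2 (2 ^ a) x)) (trans eq (*-assoc 2 (2 ^ b) y)))))

4^n≡2^[n+n] : ∀ n → 4 ^ n ≡ 2 ^ (n + n)
4^n≡2^[n+n] n = trans (^-*-assoc 2 2 n) (cong (λ e → 2 ^ (n + e)) (+-identityʳ n))

fromBits-acc : ∀ a w → foldl (λ acc b → 2 * acc + bit b) a w ≡ a * 2 ^ length w + fromBits w
fromBits-acc a [] = sym (trans (+-identityʳ _) (*-identityʳ a))
fromBits-acc a (b ∷ w) = begin
  foldl _ (2 * a + bit b) w                      ≡⟨ fromBits-acc (2 * a + bit b) w ⟩
  (2 * a + bit b) * 2 ^ length w + fromBits w    ≡⟨ regroup a (bit b) (2 ^ length w) (fromBits w) ⟩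
  a * 2 ^ length (b ∷ w) + (bit b * 2 ^ length w + fromBits w)
                                                 ≡⟨ cong (a * 2 ^ length (b ∷ w) +_) (sym (fromBits-acc (bit b) w)) ⟩
  a * 2 ^ length (b ∷ w) + fromBits (b ∷ w)      ∎
  where
  open ≡-Reasoning
  regroup : ∀ a b p f → (2 * a + b) * p + f ≡ a * (2 * p) + (b * p + f)
  regroup = solve-∀

fromBits-∷ : ∀ b w → fromBits (b ∷ w) ≡ bit b * 2 ^ length w + fromBits w
fromBits-∷ b = fromBits-acc (bit b)

fromBits-∷ʳ : ∀ w b → fromBits (w ++ [ b ]) ≡ 2 * fromBits w + bit b
fromBits-∷ʳ w b = foldl-++ _ 0 w [ b ]

-- antiWord u ≡ mirror (true ∷ u) definitionally
mirror : List Bool → List Bool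
mirror h = h ++ reverse (map not h)

mirror-∷ : ∀ b h → mirror (b ∷ h) ≡ b ∷ (mirror h ++ [ not b ])
mirror-∷ b h = cong (b ∷_) (trans (cong (h ++_) (unfold-reverse (not b) (map not h))) (sym (++-assoc h _ [ not b ])))

length-mirror : ∀ h → length (mirror h) ≡ length h + length h
length-mirror h = trans (length-++ h) (cong (length h +_) (trans (length-reverse (map not h)) (length-map not h)))

mirrorValue : List Bool → ℕ
mirrorValue []          = 0
mirrorValue (true ∷ h)  = 2 * 4 ^ length h + 2 * mirrorValue h
mirrorValue (false ∷ h) = suc (2 * mirrorValue h)

fromBits-mirror : ∀ h → fromBits (mirror h) ≡ mirrorValue h
fromBits-mirror [] = refl
fromBits-mirror (b ∷ h) = begin
  fromBits (mirror (b ∷ h))                                  ≡⟨ cong fromBits (mirror-∷ b h) ⟩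
  fromBits (b ∷ (mirror h ++ [ not b ]))                     ≡⟨ fromBits-∷ b (mirror h ++ [ not b ]) ⟩
  bit b * 2 ^ length (mirror h ++ [ not b ]) + fromBits (mirror h ++ [ not b ])
    ≡⟨ cong₂ (λ ℓ v → bit b * 2 ^ ℓ + v) length-body (fromBits-∷ʳ (mirror h) (not b)) ⟩
  bit b * (2 * 2 ^ (length h + length h)) + (2 * fromBits (mirror h) + bit (not b))
    ≡⟨ cong₂ (λ p v → bit b * (2 * p) + (2 * v + bit (not b))) (sym (4^n≡2^[n+n] (length h))) (fromBits-mirror h) ⟩
  bit b * (2 * 4 ^ length h) + (2 * mirrorValue h + bit (not b)) ≡⟨ by-bit b ⟩
  mirrorValue (b ∷ h)                                        ∎
  where
  open ≡-Reasoning
  length-body : length (mirror h ++ [ not b ]) ≡ suc (length h + length h)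
  length-body = trans (length-++ (mirror h)) (trans (+-comm _ 1) (cong suc (length-mirror h)))
  by-bit : ∀ b → bit b * (2 * 4 ^ length h) + (2 * mirrorValue h + bit (not b)) ≡ mirrorValue (b ∷ h)
  by-bit true  = cong₂ _+_ (*-identityˡ (2 * 4 ^ length h)) (+-identityʳ (2 * mirrorValue h))
  by-bit false = +-comm (2 * mirrorValue h) 1

leadingOnes : List Bool → ℕ
leadingOnes []          = 0
leadingOnes (true ∷ h)  = suc (leadingOnes h)
leadingOnes (false ∷ h) = 0

leadingOnes≤length : ∀ h → leadingOnes h ≤ length h
leadingOnes≤length []          = z≤n
leadingOnes≤length (true ∷ h)  = s≤s (leadingOnes≤length h)
leadingOnes≤length (false ∷ h) = z≤n

leadingOnes<length+length : ∀ b h → leadingOnes (b ∷ h) < length (b ∷ h) + length (b ∷ h)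
leadingOnes<length+length b h = s≤s (≤-trans (leadingOnes≤length (b ∷ h)) (m≤n+m _ (length h)))

mirrorValue-2-adic : ∀ b h → ∃ λ o → Odd o × mirrorValue (b ∷ h) ≡ 2 ^ leadingOnes (b ∷ h) * o
mirrorValue-2-adic false h  = _ , (mirrorValue h , refl) , sym (*-identityˡ (mirrorValue (false ∷ h)))
mirrorValue-2-adic true  [] = 1 , (0 , refl) , refl
mirrorValue-2-adic true (c ∷ h) with mirrorValue-2-adic c h | m≤n⇒∃[o]m+o≡n (leadingOnes<length+length c h)
... | o , (k , refl) , V≡2^t*o | s , t+1+s≡n+n = 2 * 2 ^ s + o , (2 ^ s + k , oddness (2 ^ s) k) , (begin
  2 * 4 ^ n + 2 * mirrorValue (c ∷ h)          ≡⟨ cong₂ (λ p v → 2 * p + 2 * v) (4^n≡2^[n+n] n) V≡2^t*o ⟩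
  2 * 2 ^ (n + n) + 2 * (2 ^ t * o)            ≡⟨ cong (λ e → 2 * 2 ^ e + 2 * (2 ^ t * o)) (sym t+1+s≡n+n) ⟩
  2 * 2 ^ (suc t + s) + 2 * (2 ^ t * o)        ≡⟨ cong (λ p → 2 * p + 2 * (2 ^ t * o)) (^-distribˡ-+-* 2 (suc t) s) ⟩
  2 * (2 * 2 ^ t * 2 ^ s) + 2 * (2 ^ t * o)    ≡⟨ factor (2 ^ t) (2 ^ s) o ⟩
  2 * 2 ^ t * (2 * 2 ^ s + o)                  ∎)
  where
  open ≡-Reasoning
  n = length (c ∷ h)
  t = leadingOnes (c ∷ h)
  oddness : ∀ p k → 2 * p + suc (2 * k) ≡ suc (2 * (p + k))
  oddness = solve-∀
  factor : ∀ p q o → 2 * (2 * p * q) + 2 * (p * o) ≡ 2 * p * (2 * q + o)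
  factor = solve-∀

mirrorValue-leadingOnes : ∀ {N} b c h h′ → Odd N → mirrorValue (b ∷ h) ≡ N * mirrorValue (c ∷ h′) →
                          leadingOnes (b ∷ h) ≡ leadingOnes (c ∷ h′)
mirrorValue-leadingOnes {N} b c h h′ oddN eq
  with mirrorValue-2-adic b h | mirrorValue-2-adic c h′
... | x , oddx , x-eq | y , oddy , y-eq = 2-adic-unique _ _ oddx (Odd-* oddN oddy) (begin
  2 ^ leadingOnes (b ∷ h) * x          ≡⟨ trans (sym x-eq) eq ⟩
  N * mirrorValue (c ∷ h′)             ≡⟨ cong (N *_) y-eq ⟩
  N * (2 ^ leadingOnes (c ∷ h′) * y)   ≡⟨ x∙[y∙z]≡y∙[x∙z] N (2 ^ leadingOnes (c ∷ h′)) y ⟩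
  2 ^ leadingOnes (c ∷ h′) * (N * y)   ∎)
  where
  open ≡-Reasoning
  x∙[y∙z]≡y∙[x∙z] : ∀ x y z → x * (y * z) ≡ y * (x * z)
  x∙[y∙z]≡y∙[x∙z] = solve-∀

-- v ∈ [(1 - 1/q)·M, (1 - 1/(2q))·M), with the denominators cleared
InWindow : ℕ → ℕ → ℕ → Set
InWindow q M v = M * q ≤ q * v + M × 2 * q * v + M < 2 * q * M

InWindow-*ˡ : ∀ n .{{_ : NonZero n}} {q M v} → InWindow q M v → InWindow q (n * M) (n * v)
InWindow-*ˡ n {q} {M} {v} (lower , upper) =
  subst₂ _≤_ (assoc₁ n M q) (distrib₁ n q v M) (*-monoʳ-≤ n lower) ,
  subst₂ _<_ (distrib₂ n q v M) (assoc₂ n q M) (*-monoʳ-< n upper)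
  where
  assoc₁ : ∀ n M q → n * (M * q) ≡ n * M * q
  assoc₁ = solve-∀
  distrib₁ : ∀ n q v M → n * (q * v + M) ≡ q * (n * v) + n * M
  distrib₁ = solve-∀
  distrib₂ : ∀ n q v M → n * (2 * q * v + M) ≡ 2 * q * (n * v) + n * M
  distrib₂ = solve-∀
  assoc₂ : ∀ n q M → n * (2 * q * M) ≡ 2 * q * (n * M)
  assoc₂ = solve-∀

mirrorValue-lower : ∀ h → 4 ^ length h * 2 ^ leadingOnes h ≤ 2 ^ leadingOnes h * mirrorValue h + 4 ^ length h
mirrorValue-lower []          = ≤-refl
mirrorValue-lower (false ∷ h) =
  subst₂ _≤_ (sym (*-identityʳ (4 ^ length (false ∷ h)))) (cong (_+ 4 ^ length (false ∷ h)) (sym (*-identityˡ (mirrorValue (false ∷ h)))))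
         (m≤n+m (4 ^ length (false ∷ h)) (mirrorValue (false ∷ h)))
mirrorValue-lower (true ∷ h)  = begin
  4 * M * (2 * q)               ≡⟨ split M q ⟩
  4 * (M * q) + 4 * (M * q)     ≤⟨ +-monoʳ-≤ (4 * (M * q)) (*-monoʳ-≤ 4 (mirrorValue-lower h)) ⟩
  4 * (M * q) + 4 * (q * V + M) ≡⟨ regroup M q V ⟩
  2 * q * (2 * M + 2 * V) + 4 * M ∎
  where
  open ≤-Reasoning
  M = 4 ^ length h
  q = 2 ^ leadingOnes h
  V = mirrorValue h
  split : ∀ M q → 4 * M * (2 * q) ≡ 4 * (M * q) + 4 * (M * q)
  split = solve-∀
  regroup : ∀ M q V → 4 * (M * q) + 4 * (q * V + M) ≡ 2 * q * (2 * M + 2 * V) + 4 * M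
  regroup = solve-∀

mirrorValue-upper : ∀ h → 2 * 2 ^ leadingOnes h * mirrorValue h + 4 ^ length h < 2 * 2 ^ leadingOnes h * 4 ^ length h
mirrorValue-upper []          = s≤s (s≤s z≤n)
mirrorValue-upper (false ∷ h) = begin-strict
  2 * 1 * suc (2 * V) + 4 * M ≡⟨ expand V M ⟩
  2 + 4 * V + 4 * M           <⟨ +-monoˡ-< (4 * M) (+-monoˡ-< (4 * V) (n≤1+n 3)) ⟩
  4 + 4 * V + 4 * M           ≡⟨ cong (_+ 4 * M) (sym (*-distribˡ-+ 4 1 V)) ⟩
  4 * suc V + 4 * M           ≤⟨ +-monoˡ-≤ (4 * M) (*-monoʳ-≤ 4 V<M) ⟩
  4 * M + 4 * M               ≡⟨ double M ⟩
  2 * 1 * (4 * M)             ∎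
  where
  open ≤-Reasoning
  M = 4 ^ length h
  V = mirrorValue h
  V<M : V < M
  V<M = *-cancelˡ-< (2 * 2 ^ leadingOnes h) V M (≤-<-trans (m≤m+n _ M) (mirrorValue-upper h))
  expand : ∀ V M → 2 * 1 * suc (2 * V) + 4 * M ≡ 2 + 4 * V + 4 * M
  expand = solve-∀
  double : ∀ M → 4 * M + 4 * M ≡ 2 * 1 * (4 * M)
  double = solve-∀
mirrorValue-upper (true ∷ h)  = begin-strict
  2 * (2 * q) * (2 * M + 2 * V) + 4 * M ≡⟨ regroup M q V ⟩
  8 * q * M + 4 * (2 * q * V + M)       <⟨ +-monoʳ-< (8 * q * M) (*-monoʳ-< 4 (mirrorValue-upper h)) ⟩
  8 * q * M + 4 * (2 * q * M)           ≡⟨ collect M q ⟩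
  2 * (2 * q) * (4 * M)                 ∎
  where
  open ≤-Reasoning
  M = 4 ^ length h
  q = 2 ^ leadingOnes h
  V = mirrorValue h
  regroup : ∀ M q V → 2 * (2 * q) * (2 * M + 2 * V) + 4 * M ≡ 8 * q * M + 4 * (2 * q * V + M)
  regroup = solve-∀
  collect : ∀ M q → 8 * q * M + 4 * (2 * q * M) ≡ 2 * (2 * q) * (4 * M)
  collect = solve-∀

mirrorValue-window : ∀ h → InWindow (2 ^ leadingOnes h) (4 ^ length h) (mirrorValue h)
mirrorValue-window h = mirrorValue-lower h , mirrorValue-upper h

-- 2X(q - 1) ≤ 2qv < Y(2q - 1), and (2q - 1)/(q - 1) ≤ 3 once q ≥ 2
window-ratio : ∀ {q X Y v} → 2 ≤ q → InWindow q X v → InWindow q Y v → 2 * X < 3 * Y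
window-ratio {q} {X} {Y} {v} 2≤q (lowerX , _) (_ , upperY) with m≤n⇒∃[o]m+o≡n 2≤q
... | r , refl = ≰⇒> λ 3Y≤2X → <⇒≱ (begin-strict
  Y * (3 + 3 * r)         ≡⟨ regroup Y r ⟩
  3 * Y * (1 + r)         ≤⟨ *-monoˡ-≤ (1 + r) 3Y≤2X ⟩
  2 * X * (1 + r)         ≡⟨ *-assoc 2 X (1 + r) ⟩
  2 * (X * (1 + r))       ≤⟨ *-monoʳ-≤ 2 lower ⟩
  2 * ((2 + r) * v)       ≡⟨ sym (*-assoc 2 (2 + r) v) ⟩
  2 * (2 + r) * v         <⟨ upper ⟩
  Y * (3 + 2 * r)         ∎) (*-monoʳ-≤ Y (+-monoʳ-≤ 3 (*-monoˡ-≤ r (n≤1+n 2))))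
  where
  open ≤-Reasoning
  lower : X * (1 + r) ≤ (2 + r) * v
  lower = +-cancelʳ-≤ X _ _ (subst (_≤ (2 + r) * v + X) (peel X r) lowerX)
    where peel : ∀ X r → X * (2 + r) ≡ X * (1 + r) + X
          peel = solve-∀
  upper : 2 * (2 + r) * v < Y * (3 + 2 * r)
  upper = +-cancelʳ-< Y _ _ (subst (2 * (2 + r) * v + Y <_) (peel Y r) upperY)
    where peel : ∀ Y r → 2 * (2 + r) * Y ≡ Y * (3 + 2 * r) + Y
          peel = solve-∀
  regroup : ∀ Y r → Y * (3 + 3 * r) ≡ 3 * Y * (1 + r)
  regroup = solve-∀

Within3/2 : ℕ → ℕ → Set
Within3/2 x y = 2 * x < 3 * y × 2 * y < 3 * x

window-within3/2 : ∀ {q X Y v} → 2 ≤ q → InWindow q X v → InWindow q Y v → Within3/2 X Y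
window-within3/2 2≤q wX wY = window-ratio 2≤q wX wY , window-ratio 2≤q wY wX

ratioOfAntipal⇒within3/2 : ∀ {N} → Odd N → RatioOfAntipal N → ∃₂ λ m k → Within3/2 (N * 4 ^ k) (4 ^ m)
ratioOfAntipal⇒within3/2 {N} oddN@(_ , refl) (A , B , (u , refl) , (v , refl) , A≡N*B) =
  length (true ∷ u) , length (true ∷ v) , window-within3/2 2≤q windowB windowA
  where
  VA≡N*VB : mirrorValue (true ∷ u) ≡ N * mirrorValue (true ∷ v)
  VA≡N*VB = trans (sym (fromBits-mirror (true ∷ u))) (trans A≡N*B (cong (N *_) (fromBits-mirror (true ∷ v))))
  q = 2 ^ leadingOnes (true ∷ v)
  2≤q : 2 ≤ q
  2≤q = *-monoʳ-≤ 2 (m^n>0 2 (leadingOnes v))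
  windowA : InWindow q (4 ^ length (true ∷ u)) (N * mirrorValue (true ∷ v))
  windowA = subst₂ (λ p x → InWindow p (4 ^ length (true ∷ u)) x)
                   (cong (2 ^_) (mirrorValue-leadingOnes true true u v oddN VA≡N*VB)) VA≡N*VB
                   (mirrorValue-window (true ∷ u))
  windowB : InWindow q (N * 4 ^ length (true ∷ v)) (N * mirrorValue (true ∷ v))
  windowB = InWindow-*ˡ N {q} {4 ^ length (true ∷ v)} {mirrorValue (true ∷ v)} (mirrorValue-window (true ∷ v))

¬within3/2-power-of-4 : ∀ J {N} → 3 * 4 ^ suc J ≤ 2 * N → 3 * N ≤ 2 * 4 ^ (2 + J) →
                        ∀ m k → ¬ Within3/2 (N * 4 ^ k) (4 ^ m)
¬within3/2-power-of-4 J {N} lo hi m k (below , above) with m ≤? k + suc J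
... | yes m≤ = <⇒≱ below (begin
  3 * 4 ^ m                 ≤⟨ *-monoʳ-≤ 3 (^-monoʳ-≤ 4 m≤) ⟩
  3 * 4 ^ (k + suc J)       ≡⟨ cong (3 *_) (^-distribˡ-+-* 4 k (suc J)) ⟩
  3 * (4 ^ k * 4 ^ suc J)   ≡⟨ x∙[y∙z]≡y∙[x∙z] 3 (4 ^ k) _ ⟩
  4 ^ k * (3 * 4 ^ suc J)   ≤⟨ *-monoʳ-≤ (4 ^ k) lo ⟩
  4 ^ k * (2 * N)           ≡⟨ x∙[y∙z]≡y∙[z∙x] (4 ^ k) 2 N ⟩
  2 * (N * 4 ^ k)           ∎)
  where
  open ≤-Reasoning
  x∙[y∙z]≡y∙[x∙z] : ∀ x y z → x * (y * z) ≡ y * (x * z)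
  x∙[y∙z]≡y∙[x∙z] = solve-∀
  x∙[y∙z]≡y∙[z∙x] : ∀ x y z → x * (y * z) ≡ y * (z * x)
  x∙[y∙z]≡y∙[z∙x] = solve-∀
... | no m≰ = <⇒≱ above (begin
  3 * (N * 4 ^ k)               ≡⟨ x∙[y∙z]≡z∙[x∙y] 3 N (4 ^ k) ⟩
  4 ^ k * (3 * N)               ≤⟨ *-monoʳ-≤ (4 ^ k) hi ⟩
  4 ^ k * (2 * (4 * 4 ^ suc J)) ≡⟨ regroup (4 ^ k) (4 ^ suc J) ⟩
  2 * (4 * (4 ^ k * 4 ^ suc J)) ≡⟨ cong (λ p → 2 * (4 * p)) (sym (^-distribˡ-+-* 4 k (suc J))) ⟩
  2 * 4 ^ suc (k + suc J)       ≤⟨ *-monoʳ-≤ 2 (^-monoʳ-≤ 4 (≰⇒> m≰)) ⟩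
  2 * 4 ^ m                     ∎)
  where
  open ≤-Reasoning
  x∙[y∙z]≡z∙[x∙y] : ∀ x y z → x * (y * z) ≡ z * (x * y)
  x∙[y∙z]≡z∙[x∙y] = solve-∀
  regroup : ∀ a p → a * (2 * (4 * p)) ≡ 2 * (4 * (a * p))
  regroup = solve-∀

candidate : ℕ → ℕ → ℕ
candidate J i = suc (2 * (4 ^ suc J + i))

candidate-injective : ∀ J {i j} → candidate J i ≡ candidate J j → i ≡ j
candidate-injective J eq = +-cancelˡ-≡ (4 ^ suc J) _ _ (*-cancelˡ-≡ _ _ 2 (suc-injective eq))

candidate-∈V : ∀ J {i} → i < 4 ^ J → InV (candidate J i)
candidate-∈V J {i} i<x = s≤s z≤n , λ ratio →
  let m , k , within = ratioOfAntipal⇒within3/2 (4 ^ suc J + i , refl) ratio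
  in ¬within3/2-power-of-4 J {candidate J i} lo hi m k within
  where
  x = 4 ^ J
  open ≤-Reasoning
  lo : 3 * (4 * x) ≤ 2 * candidate J i
  lo = subst (3 * (4 * x) ≤_) (sym (expand x i)) (m≤m+n _ _)
    where expand : ∀ x i → 2 * suc (2 * (4 * x + i)) ≡ 3 * (4 * x) + (4 * x + 4 * i + 2)
          expand = solve-∀
  hi : 3 * candidate J i ≤ 2 * (4 * (4 * x))
  hi = begin
    3 * candidate J i      ≡⟨ expand x i ⟩
    24 * x + 6 * i + 3     ≤⟨ +-monoʳ-≤ (24 * x + 6 * i) (m≤m+n 3 3) ⟩
    24 * x + 6 * i + 6     ≡⟨ regroup x i ⟩
    24 * x + 6 * suc i     ≤⟨ +-monoʳ-≤ (24 * x) (*-monoʳ-≤ 6 i<x) ⟩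
    24 * x + 6 * x         ≤⟨ +-monoʳ-≤ (24 * x) (*-monoˡ-≤ x (m≤m+n 6 2)) ⟩
    24 * x + 8 * x         ≡⟨ collect x ⟩
    2 * (4 * (4 * x))      ∎
    where expand : ∀ x i → 3 * suc (2 * (4 * x + i)) ≡ 24 * x + 6 * i + 3
          expand = solve-∀
          regroup : ∀ x i → 24 * x + 6 * i + 6 ≡ 24 * x + 6 * suc i
          regroup = solve-∀
          collect : ∀ x → 24 * x + 8 * x ≡ 2 * (4 * (4 * x))
          collect = solve-∀

candidate≤ : ∀ J {i} → i < 4 ^ J → candidate J i ≤ 10 * 4 ^ J
candidate≤ J {i} i<x = begin
  candidate J i        ≡⟨ expand x i ⟩
  8 * x + 2 * i + 1    ≤⟨ +-monoʳ-≤ (8 * x + 2 * i) (n≤1+n 1) ⟩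
  8 * x + 2 * i + 2    ≡⟨ regroup x i ⟩
  8 * x + 2 * suc i    ≤⟨ +-monoʳ-≤ (8 * x) (*-monoʳ-≤ 2 i<x) ⟩
  8 * x + 2 * x        ≡⟨ collect x ⟩
  10 * x               ∎
  where
  open ≤-Reasoning
  x = 4 ^ J
  expand : ∀ x i → suc (2 * (4 * x + i)) ≡ 8 * x + 2 * i + 1
  expand = solve-∀
  regroup : ∀ x i → 8 * x + 2 * i + 2 ≡ 8 * x + 2 * suc i
  regroup = solve-∀
  collect : ∀ x → 8 * x + 2 * x ≡ 10 * x
  collect = solve-∀

candidates-count : ∀ J {n} → 10 * 4 ^ J ≤ n → CountAtLeast n (4 ^ J)
candidates-count J 10x≤n =
  map (candidate J) (upTo (4 ^ J)) ,
  Unique.map⁺ (candidate-injective J) (Unique.upTo⁺ (4 ^ J)) ,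
  all-map⁺ (All.map (λ i<x → candidate-∈V J i<x , ≤-trans (candidate≤ J i<x) 10x≤n) (all-upTo (4 ^ J))) ,
  ≤-reflexive (sym (trans (length-map (candidate J) (upTo (4 ^ J))) (length-upTo (4 ^ J))))

powers-of-4-bracket : ∀ a .{{_ : NonZero a}} {n} → a ≤ n → ∃ λ J → a * 4 ^ J ≤ n × n < a * 4 ^ suc J
powers-of-4-bracket a {zero} a≤0 = ⊥-elim (<⇒≱ (>-nonZero⁻¹ a) a≤0)
powers-of-4-bracket a {suc n} a≤1+n with a ≤? n
... | no a≰n = 0 , subst (_≤ suc n) (sym (*-identityʳ a)) a≤1+n ,
               subst (_< a * 4) (≤-antisym a≤1+n (≰⇒> a≰n)) (m<m*n a 4 (s≤s (s≤s z≤n)))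
... | yes a≤n with powers-of-4-bracket a a≤n
...   | J , lo , hi with suc n <? a * 4 ^ suc J
...     | yes below = J , m≤n⇒m≤1+n lo , below
...     | no ¬below = suc J , ≮⇒≥ ¬below ,
                      <-≤-trans (s≤s hi) (*-monoʳ-< a (^-monoʳ-< 4 (s≤s (s≤s z≤n)) (n<1+n (suc J))))

corollary19 : ∀ (k : ℕ) → ∃ λ (n₀ : ℕ) → ∀ (n : ℕ) → n₀ ≤ n →
    ∃ λ (c : ℕ) → CountAtLeast n c × n * (suc k ∸ 60) ≤ 60 * suc k * c
corollary19 k = 10 , λ n 10≤n →
  let J , lo , hi = powers-of-4-bracket 10 10≤n
  in 4 ^ J , candidates-count J lo , density J hi
  where
  density : ∀ J {n} → n < 10 * 4 ^ suc J → n * (suc k ∸ 60) ≤ 60 * suc k * 4 ^ J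
  density J {n} hi = begin
    n * (suc k ∸ 60)         ≤⟨ *-monoʳ-≤ n (m∸n≤m (suc k) 60) ⟩
    n * suc k                ≤⟨ *-monoˡ-≤ (suc k) (<⇒≤ hi) ⟩
    10 * (4 * x) * suc k     ≤⟨ *-monoˡ-≤ (suc k) (subst (_≤ 60 * x) (*-assoc 10 4 x) (*-monoˡ-≤ x (m≤m+n 40 20))) ⟩
    60 * x * suc k           ≡⟨ *-assoc 60 x (suc k) ⟩
    60 * (x * suc k)         ≡⟨ cong (60 *_) (*-comm x (suc k)) ⟩
    60 * (suc k * x)         ≡⟨ sym (*-assoc 60 (suc k) x) ⟩
    60 * suc k * x           ∎
    where
    open ≤-Reasoning
    x = 4 ^ J
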